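{- Let $n\geq 2$ be an integer, and let $C=\{\vec x_1,\ldots,\vec x_k\}$ be a clique of order $k$ of the graph $\widehat H_n$. Then there exists a map $f\colon\mathbb F_2^n\to\mathbb F_2$ such that each $\vec x_i\in C$ lies in a $2$-cycle of the phase space $\Gamma([K_n,f,\mathrm{id}])$, and no two distinct $\vec x_i,\vec x_j\in C$ lie in the same $2$-cycle of $\Gamma([K_n,f,\mathrm{id}])$.
   Context: For $f\colon\mathbb F_2^n\to\mathbb F_2$ and $i\in\{1,\ldots,n\}$, let $L_i\colon\mathbb F_2^n\to\mathbb F_2^n$ be $L_i(x_1,\ldots,x_n)=(x_1,\ldots,x_{i-1},f(x_1,\ldots,x_n),x_{i+1},\ldots,x_n)$. With $\mathrm{id}=12\cdots n$ the identity permutation, the SDS map is $F=[K_n,f,\mathrm{id}]=L_n\circ L_{n-1}\circ\cdots\circ L_1$. The phase space $\Gamma(F)$ is the directed graph on vertex set $\mathbb F_2^n$ with an edge $\vec x\to F(\vec x)$ for each $\vec x$; a $2$-cycle is a directed cycle of length $2$, i.e. a set $\{\vec x,F(\vec x)\}$ with $F(\vec x)\neq\vec x$ and $F(F(\vec x))=\vec x$. A vector $(y_1,\ldots,y_n)\in\mathbb F_2^n$ contains the subsequence $101$ if there exist indices $i_1<i_2<i_3$ with $y_{i_1}=1$, $y_{i_2}=0$, $y_{i_3}=1$. The graph $\widehat H_n$ is the simple undirected graph whose vertex set is $\{(x_1,\ldots,x_n)\in\mathbb F_2^n: x_1=0\}$, with $\vec x,\vec y$ adjacent iff $\vec x\neq\vec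 y$ and $\vec x+\vec y$ contains the subsequence $101$. -}

module Defs where

open import Data.Bool using (Bool; true; false; _xor_)
open import Data.Nat using (ℕ; suc)
open import Data.Fin using (Fin; _<_; toℕ; fromℕ<)
open import Data.Vec using (Vec; lookup; _[_]≔_; zipWith; head; allFin; foldl)
open import Data.List using (List)
open import Data.List.Membership.Propositional using (_∈_)
open import Data.List.Relation.Unary.Unique.Propositional using (Unique)
open import Data.Product using (Σ; ∃; _×_; _,_)
open import Data.Sum using (_⊎_)
open import Relation.Binary.PropositionalEquality using (_≡_; _≢_)

-- 𝔽₂ is modelled by Bool, with addition = xor.
-- 𝔽₂ⁿ is Vec Bool n; coordinate i (1-based in the paper) is Fin index i-1.
𝔽₂^ : ℕ → Set
𝔽₂^ n = Vec Bool n

_⊕_ : ∀ {n} → 𝔽₂^ n → 𝔽₂^ n → 𝔽₂^ n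
_⊕_ = zipWith _xor_

L : ∀ {n} → (𝔽₂^ n → Bool) → Fin n → 𝔽₂^ n → 𝔽₂^ n
L f i x = x [ i ]≔ f x

-- SDS map [K_n, f, id] = L_n ∘ ... ∘ L_1 : apply L_1 first, then L_2, ..., L_n
SDS : ∀ {n} → (𝔽₂^ n → Bool) → 𝔽₂^ n → 𝔽₂^ n
SDS {n} f x = foldl (λ _ → 𝔽₂^ n) (λ y i → L f i y) x (allFin n)

OnTwoCycle : ∀ {n} → (𝔽₂^ n → 𝔽₂^ n) → 𝔽₂^ n → Set
OnTwoCycle F x = (F x ≢ x) × (F (F x) ≡ x)

SameTwoCycle : ∀ {n} → (𝔽₂^ n → 𝔽₂^ n) → 𝔽₂^ n → 𝔽₂^ n → Set
SameTwoCycle {n} F x y =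
  Σ (𝔽₂^ n) λ z → OnTwoCycle F z × (x ≡ z ⊎ x ≡ F z) × (y ≡ z ⊎ y ≡ F z)

Contains101 : ∀ {n} → 𝔽₂^ n → Set
Contains101 {n} y =
  Σ (Fin n) λ i₁ → Σ (Fin n) λ i₂ → Σ (Fin n) λ i₃ →
    (i₁ < i₂) × (i₂ < i₃) ×
    (lookup y i₁ ≡ true) × (lookup y i₂ ≡ false) × (lookup y i₃ ≡ true)

IsVertexĤ : ∀ {n} → 𝔽₂^ (suc n) → Set
IsVertexĤ x = head x ≡ false

AdjĤ : ∀ {n} → 𝔽₂^ n → 𝔽₂^ n → Set
AdjĤ x y = (x ≢ y) × Contains101 (x ⊕ y)

-- C (given as a duplicate-free list, so its length is the order k) is a clique of Ĥ_n
IsCliqueĤ : ∀ {n} → List (𝔽₂^ (suc n)) → Set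
IsCliqueĤ C =
  Unique C ×
  (∀ {x} → x ∈ C → IsVertexĤ x) ×
  (∀ {x y} → x ∈ C → y ∈ C → x ≢ y → AdjĤ x y)

-- Choose f so that F = [K_n, f, id] swaps every clique element x with its complement x̄.
-- While F sweeps x, the state just before L_{k+1} is x with its first k coordinates
-- complemented, so F x = x̄ as soon as f takes the value ¬ x_{k+1} at each of these n states;
-- the same for x̄.  Two such requirements never conflict: if the states for coordinates k, k′
-- of sources b, b′ ∈ {x, x̄, y, ȳ} coincide, then b + b′ is the interval 0…01…10…0 between
-- k and k′.  For x ≠ y that is impossible, since both x + y and its complement contain 101
-- (as x₁ = y₁ = 0) while an interval does not; for x = y, b + b′ is constant, and the only
-- constant interval (its last bit is 0) is the empty one, k = k′.
-- Finally x̄ starts with 1, so no other clique element lies on the 2-cycle {x, x̄}.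
module Submission where

open import Defs
open import Function using (_∘_)
open import Data.Bool using (Bool; true; false; not; _xor_)
open import Data.Bool.Properties
  using ( not-involutive; not-injective; xor-same; xor-identityʳ; xor-inverseˡ; xor-inverseʳ
        ; xor-∧-commutativeRing)
  renaming (_≟_ to _≟ᵇ_)
open import Algebra.Bundles using (CommutativeRing)
open import Algebra.Properties.CommutativeSemigroup
  (CommutativeRing.+-commutativeSemigroup xor-∧-commutativeRing) using (interchange)
open import Data.Nat using (ℕ; zero; suc; _≤_; z<s)
import Data.Nat.Properties as ℕ
open import Data.Fin using (Fin; zero; suc; fromℕ)
open import Data.Fin.Properties using (_<?_; <-cmp; ≤fromℕ)
open import Data.Vec using (Vec; []; _∷_; lookup; map; tabulate; foldl; head)
open import Data.Vec.Properties
  using ( lookup-map; lookup-zipWith; lookup∘tabulate; tabulate-cong; tabulate∘lookup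
        ; map-id; map-∘; map-cong; ≡-dec)
open import Data.List using (List; []; _∷_; cartesianProductWith; allFin)
open import Data.List.Membership.Propositional using (_∈_)
open import Data.List.Membership.Propositional.Properties
  using (∈-cartesianProductWith⁺; ∈-cartesianProductWith⁻; ∈-allFin)
open import Data.List.Relation.Unary.Any using (here; there)
open import Data.Product using (Σ; _×_; _,_; proj₁; proj₂)
open import Data.Sum using (_⊎_; inj₁; inj₂)
open import Data.Empty using (⊥-elim)
open import Relation.Binary.Definitions using (DecidableEquality; tri<; tri≈; tri>)
open import Relation.Binary.PropositionalEquality
open import Relation.Nullary using (¬_; yes; no; does; contradiction)
open import Relation.Nullary.Decidable using (dec-true; dec-false)

lookup-ext : ∀ {A : Set} {n} {xs ys : Vec A n} → (∀ j → lookup xs j ≡ lookup ys j) → xs ≡ ys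
lookup-ext {xs = xs} {ys} eq = begin
  xs                   ≡⟨ sym (tabulate∘lookup xs) ⟩
  tabulate (lookup xs) ≡⟨ tabulate-cong eq ⟩
  tabulate (lookup ys) ≡⟨ tabulate∘lookup ys ⟩
  ys                   ∎
  where open ≡-Reasoning

xor-swap : ∀ p q a b → p xor a ≡ q xor b → a xor b ≡ p xor q
xor-swap false false a b e = trans (cong (a xor_) (sym e)) (xor-same a)
xor-swap true  true  a b e = trans (cong (a xor_) (sym (not-injective e))) (xor-same a)
xor-swap false true  a b e = trans (cong (_xor b) e) (xor-inverseˡ b)
xor-swap true  false a b e = trans (cong (a xor_) (sym e)) (xor-inverseʳ a)

complement : ∀ {n} → 𝔽₂^ n → 𝔽₂^ n
complement = map not

complement-involutive : ∀ {n} (x : 𝔽₂^ n) → complement (complement x) ≡ x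
complement-involutive x = begin
  map not (map not x) ≡⟨ sym (map-∘ not not x) ⟩
  map (not ∘ not) x   ≡⟨ map-cong not-involutive x ⟩
  map (λ a → a) x     ≡⟨ map-id x ⟩
  x                   ∎
  where open ≡-Reasoning

complement-≢ : ∀ {n} (x : 𝔽₂^ (suc n)) → complement x ≢ x
complement-≢ (true  ∷ _) ()
complement-≢ (false ∷ _) ()

flipBefore : ∀ {n} → Fin n → 𝔽₂^ n → 𝔽₂^ n
flipBefore zero    x       = x
flipBefore (suc k) (a ∷ x) = not a ∷ flipBefore k x

lookup-flipBefore : ∀ {n} (k j : Fin n) (x : 𝔽₂^ n) →
  lookup (flipBefore k x) j ≡ does (j <? k) xor lookup x j
lookup-flipBefore zero    j       x       = refl
lookup-flipBefore (suc k) zero    (a ∷ x) = refl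
lookup-flipBefore (suc k) (suc j) (a ∷ x) = lookup-flipBefore k j x

lookup-flipBefore-self : ∀ {n} (k : Fin n) (x : 𝔽₂^ n) → lookup (flipBefore k x) k ≡ lookup x k
lookup-flipBefore-self k x =
  trans (lookup-flipBefore k k x) (cong (_xor lookup x k) (dec-false (k <? k) (ℕ.<-irrefl refl)))

flipAll : ∀ {n} → Bool → 𝔽₂^ n → 𝔽₂^ n
flipAll β = map (β xor_)

flipAll-⊕ : ∀ {n} β β′ (x x′ : 𝔽₂^ n) → flipAll β x ⊕ flipAll β′ x′ ≡ flipAll (β xor β′) (x ⊕ x′)
flipAll-⊕ β β′ x x′ = lookup-ext λ j → begin
  lookup (flipAll β x ⊕ flipAll β′ x′) j
    ≡⟨ lookup-zipWith _xor_ j (flipAll β x) (flipAll β′ x′) ⟩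
  lookup (flipAll β x) j xor lookup (flipAll β′ x′) j
    ≡⟨ cong₂ _xor_ (lookup-map j _ x) (lookup-map j _ x′) ⟩
  (β xor lookup x j) xor (β′ xor lookup x′ j)
    ≡⟨ interchange β _ β′ _ ⟩
  (β xor β′) xor (lookup x j xor lookup x′ j)
    ≡⟨ cong ((β xor β′) xor_) (sym (lookup-zipWith _xor_ j x x′)) ⟩
  (β xor β′) xor lookup (x ⊕ x′) j
    ≡⟨ sym (lookup-map j _ (x ⊕ x′)) ⟩
  lookup (flipAll (β xor β′) (x ⊕ x′)) j
    ∎
  where open ≡-Reasoning

head-⊕ : ∀ {n} (x x′ : 𝔽₂^ (suc n)) → head (x ⊕ x′) ≡ head x xor head x′
head-⊕ (_ ∷ _) (_ ∷ _) = refl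

SDS-step : ∀ {n} → (𝔽₂^ n → Bool) → 𝔽₂^ n → Fin n → 𝔽₂^ n
SDS-step f y i = L f i y

foldl-SDS-step-suc : ∀ {m n} (f : 𝔽₂^ (suc n) → Bool) b y (is : Fin m → Fin n) →
  foldl _ (SDS-step f) (b ∷ y) (tabulate (suc ∘ is)) ≡
  b ∷ foldl _ (SDS-step (f ∘ (b ∷_))) y (tabulate is)
foldl-SDS-step-suc {zero}  f b y is = refl
foldl-SDS-step-suc {suc m} f b y is =
  foldl-SDS-step-suc f b (L (f ∘ (b ∷_)) (is zero) y) (is ∘ suc)

SDS-∷ : ∀ {n} (f : 𝔽₂^ (suc n) → Bool) a x →
  SDS f (a ∷ x) ≡ f (a ∷ x) ∷ SDS (f ∘ (f (a ∷ x) ∷_)) x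
SDS-∷ f a x = foldl-SDS-step-suc f (f (a ∷ x)) x (λ i → i)

SDS≡complement : ∀ {n} (f : 𝔽₂^ n → Bool) (x : 𝔽₂^ n) →
  (∀ k → f (flipBefore k x) ≡ not (lookup x k)) → SDS f x ≡ complement x
SDS≡complement f []      _      = refl
SDS≡complement f (a ∷ x) f-flip = begin
  SDS f (a ∷ x)                          ≡⟨ SDS-∷ f a x ⟩
  f (a ∷ x) ∷ SDS (f ∘ (f (a ∷ x) ∷_)) x ≡⟨ cong (λ b → b ∷ SDS (f ∘ (b ∷_)) x) (f-flip zero) ⟩
  not a ∷ SDS (f ∘ (not a ∷_)) x
    ≡⟨ cong (not a ∷_) (SDS≡complement (f ∘ (not a ∷_)) x (f-flip ∘ suc)) ⟩
  not a ∷ complement x                   ∎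
  where open ≡-Reasoning

swap⇒OnTwoCycle : ∀ {n} {F : 𝔽₂^ n → 𝔽₂^ n} {x x′} →
  x′ ≢ x → F x ≡ x′ → F x′ ≡ x → OnTwoCycle F x
swap⇒OnTwoCycle x′≢x Fx≡x′ Fx′≡x =
  (λ Fx≡x → x′≢x (trans (sym Fx≡x′) Fx≡x)) , trans (cong _ Fx≡x′) Fx′≡x

SameTwoCycle⇒image : ∀ {n} {F : 𝔽₂^ n → 𝔽₂^ n} {x y} →
  x ≢ y → SameTwoCycle F x y → y ≡ F x ⊎ x ≡ F y
SameTwoCycle⇒image x≢y (z , _ , inj₁ x≡z , inj₁ y≡z) = ⊥-elim (x≢y (trans x≡z (sym y≡z)))
SameTwoCycle⇒image x≢y (z , _ , inj₂ x≡Fz , inj₂ y≡Fz) = ⊥-elim (x≢y (trans x≡Fz (sym y≡Fz)))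
SameTwoCycle⇒image x≢y (z , _ , inj₁ refl , inj₂ y≡Fx) = inj₁ y≡Fx
SameTwoCycle⇒image x≢y (z , _ , inj₂ x≡Fy , inj₁ refl) = inj₂ x≡Fy

interval : ∀ {n} → Fin n → Fin n → 𝔽₂^ n
interval k k′ = tabulate (λ j → does (j <? k) xor does (j <? k′))

lookup-interval : ∀ {n} (k k′ j : Fin n) {b b′} →
  does (j <? k) ≡ b → does (j <? k′) ≡ b′ → lookup (interval k k′) j ≡ b xor b′
lookup-interval k k′ j e e′ = trans (lookup∘tabulate _ j) (cong₂ _xor_ e e′)

flipBefore-≡⇒⊕≡interval : ∀ {n} {k k′ : Fin n} {y y′} →
  flipBefore k y ≡ flipBefore k′ y′ → y ⊕ y′ ≡ interval k k′
flipBefore-≡⇒⊕≡interval {k = k} {k′} {y} {y′} eq = lookup-ext λ j → begin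
  lookup (y ⊕ y′) j
    ≡⟨ lookup-zipWith _xor_ j y y′ ⟩
  lookup y j xor lookup y′ j
    ≡⟨ xor-swap (does (j <? k)) (does (j <? k′)) (lookup y j) (lookup y′ j) (begin
      does (j <? k) xor lookup y j   ≡⟨ sym (lookup-flipBefore k j y) ⟩
      lookup (flipBefore k y) j      ≡⟨ cong (λ v → lookup v j) eq ⟩
      lookup (flipBefore k′ y′) j    ≡⟨ lookup-flipBefore k′ j y′ ⟩
      does (j <? k′) xor lookup y′ j ∎) ⟩
  does (j <? k) xor does (j <? k′)
    ≡⟨ sym (lookup∘tabulate _ j) ⟩
  lookup (interval k k′) j
    ∎
  where open ≡-Reasoning

interval-last : ∀ {n} (k k′ : Fin (suc n)) → lookup (interval k k′) (fromℕ n) ≡ false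
interval-last {n} k k′ = lookup-interval k k′ (fromℕ n)
  (dec-false (fromℕ n <? k) (ℕ.≤⇒≯ (≤fromℕ k))) (dec-false (fromℕ n <? k′) (ℕ.≤⇒≯ (≤fromℕ k′)))

interval-false⇒≡ : ∀ {n} {k k′ : Fin n} → (∀ j → lookup (interval k k′) j ≡ false) → k ≡ k′
interval-false⇒≡ {k = k} {k′} allFalse with <-cmp k k′
... | tri≈ _ k≡k′ _ = k≡k′
... | tri< k<k′ _ _ = contradiction (trans (sym (allFalse k)) (lookup-interval k k′ k
        (dec-false (k <? k) (ℕ.<-irrefl refl)) (dec-true (k <? k′) k<k′))) λ ()
... | tri> _ _ k′<k = contradiction (trans (sym (allFalse k′)) (lookup-interval k k′ k′
        (dec-true (k′ <? k) k′<k) (dec-false (k′ <? k′) (ℕ.<-irrefl refl)))) λ ()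

interval-constant⇒≡ : ∀ {n} {k k′ : Fin (suc n)} {β} → (∀ j → lookup (interval k k′) j ≡ β) → k ≡ k′
interval-constant⇒≡ {n} {k} {k′} constant =
  interval-false⇒≡ λ j → trans (constant j) (trans (sym (constant (fromℕ n))) (interval-last k k′))

¬Contains101-interval : ∀ {n} (k k′ : Fin n) → ¬ Contains101 (interval k k′)
¬Contains101-interval k k′ (i₁ , i₂ , i₃ , i₁<i₂ , i₂<i₃ , v₁ , v₂ , v₃) with i₂ <? k | i₂ <? k′
... | yes i₂<k | yes i₂<k′ = contradiction (trans (sym v₁) (lookup-interval k k′ i₁
        (dec-true (i₁ <? k) (ℕ.<-trans i₁<i₂ i₂<k))
        (dec-true (i₁ <? k′) (ℕ.<-trans i₁<i₂ i₂<k′)))) λ ()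
... | yes i₂<k | no  i₂≮k′ = contradiction (trans (sym v₂) (lookup-interval k k′ i₂
        (dec-true (i₂ <? k) i₂<k) (dec-false (i₂ <? k′) i₂≮k′))) λ ()
... | no  i₂≮k | yes i₂<k′ = contradiction (trans (sym v₂) (lookup-interval k k′ i₂
        (dec-false (i₂ <? k) i₂≮k) (dec-true (i₂ <? k′) i₂<k′))) λ ()
... | no  i₂≮k | no  i₂≮k′ = contradiction (trans (sym v₃) (lookup-interval k k′ i₃
        (dec-false (i₃ <? k) (i₂≮k ∘ ℕ.<-trans i₂<i₃))
        (dec-false (i₃ <? k′) (i₂≮k′ ∘ ℕ.<-trans i₂<i₃)))) λ ()

Contains101-flipAll : ∀ {n} β (v : 𝔽₂^ (suc n)) →
  head v ≡ false → Contains101 v → Contains101 (flipAll β v)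
Contains101-flipAll false v _ (i₁ , i₂ , i₃ , i₁<i₂ , i₂<i₃ , v₁ , v₂ , v₃) =
  i₁ , i₂ , i₃ , i₁<i₂ , i₂<i₃ ,
  trans (lookup-map i₁ _ v) v₁ , trans (lookup-map i₂ _ v) v₂ , trans (lookup-map i₃ _ v) v₃
Contains101-flipAll true (false ∷ v) _ (zero , _ , _ , _ , _ , () , _)
Contains101-flipAll true (false ∷ v) _ (suc i₁ , i₂ , _ , i₁<i₂ , _ , v₁ , v₂ , _) =
  zero , suc i₁ , i₂ , z<s , i₁<i₂ , refl , flipped (suc i₁) v₁ , flipped i₂ v₂
  where
  flipped : ∀ i {b} → lookup (false ∷ v) i ≡ b → lookup (flipAll true (false ∷ v)) i ≡ not b
  flipped i eq = trans (lookup-map i _ (false ∷ v)) (cong not eq)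

cliqueDifference≡interval⇒≡ : ∀ {n} {C : List (𝔽₂^ (suc n))} {x x′ k k′} β →
  IsCliqueĤ C → x ∈ C → x′ ∈ C → flipAll β (x ⊕ x′) ≡ interval k k′ → k ≡ k′
cliqueDifference≡interval⇒≡ {x = x} {x′} {k} {k′} β (_ , vertex , adjacent) x∈C x′∈C D≡I
  with ≡-dec _≟ᵇ_ x x′
... | yes refl = interval-constant⇒≡ λ j → begin
  lookup (interval k k′) j     ≡⟨ cong (λ v → lookup v j) (sym D≡I) ⟩
  lookup (flipAll β (x ⊕ x)) j ≡⟨ lookup-map j _ (x ⊕ x) ⟩
  β xor lookup (x ⊕ x) j       ≡⟨ cong (β xor_) (lookup-zipWith _xor_ j x x) ⟩
  β xor (lookup x j xor lookup x j) ≡⟨ cong (β xor_) (xor-same (lookup x j)) ⟩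
  β xor false                  ≡⟨ xor-identityʳ β ⟩
  β                            ∎
  where open ≡-Reasoning
... | no x≢x′ = contradiction (subst Contains101 D≡I D∋101) (¬Contains101-interval k k′)
  where
  D∋101 : Contains101 (flipAll β (x ⊕ x′))
  D∋101 = Contains101-flipAll β (x ⊕ x′)
            (trans (head-⊕ x x′) (cong₂ _xor_ (vertex x∈C) (vertex x′∈C)))
            (proj₂ (adjacent x∈C x′∈C x≢x′))

bases : ∀ {n} → List (𝔽₂^ n) → List (𝔽₂^ n)
bases = cartesianProductWith flipAll (false ∷ true ∷ [])

flipIndex-unique : ∀ {n} {C : List (𝔽₂^ (suc n))} {y y′ k k′} →
  IsCliqueĤ C → y ∈ bases C → y′ ∈ bases C → flipBefore k y ≡ flipBefore k′ y′ → k ≡ k′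
flipIndex-unique {C = C} clique y∈ y′∈ eq
  with ∈-cartesianProductWith⁻ flipAll (false ∷ true ∷ []) C y∈
     | ∈-cartesianProductWith⁻ flipAll (false ∷ true ∷ []) C y′∈
... | β , x , _ , x∈C , refl | β′ , x′ , _ , x′∈C , refl =
  cliqueDifference≡interval⇒≡ (β xor β′) clique x∈C x′∈C
    (trans (sym (flipAll-⊕ β β′ x x′)) (flipBefore-≡⇒⊕≡interval eq))

IsFunctional : {A B : Set} → List (A × B) → Set
IsFunctional g = ∀ {a b b′} → (a , b) ∈ g → (a , b′) ∈ g → b ≡ b′

module _ {A B : Set} (_≟_ : DecidableEquality A) (default : B) where

  fromGraph : List (A × B) → A → B
  fromGraph []              a = default
  fromGraph ((a′ , b) ∷ g) a with a′ ≟ a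
  ... | yes _ = b
  ... | no  _ = fromGraph g a

  fromGraph-∈ : ∀ {g a b} → IsFunctional g → (a , b) ∈ g → fromGraph g a ≡ b
  fromGraph-∈ {(a′ , b′) ∷ g} {a} functional ab∈ with a′ ≟ a | ab∈
  ... | yes refl | _         = functional (here refl) ab∈
  ... | no  a′≢a | here refl = contradiction refl a′≢a
  ... | no  _    | there ab∈g = fromGraph-∈ (λ p q → functional (there p) (there q)) ab∈g

requirements : ∀ {n} → List (𝔽₂^ n) → List (𝔽₂^ n × Bool)
requirements {n} C =
  cartesianProductWith (λ y k → flipBefore k y , not (lookup y k)) (bases C) (allFin n)

requirements-functional : ∀ {n} {C : List (𝔽₂^ (suc n))} →
  IsCliqueĤ C → IsFunctional (requirements C)
requirements-functional {C = C} clique r∈ r′∈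
  with ∈-cartesianProductWith⁻ _ (bases C) (allFin _) r∈
     | ∈-cartesianProductWith⁻ _ (bases C) (allFin _) r′∈
... | y , k , y∈ , _ , refl | y′ , k′ , y′∈ , _ , r′≡
  with refl ← flipIndex-unique clique y∈ y′∈ (cong proj₁ r′≡) = begin
  not (lookup y k)                 ≡⟨ cong not (sym (lookup-flipBefore-self k y)) ⟩
  not (lookup (flipBefore k y) k)  ≡⟨ cong (λ z → not (lookup z k)) (cong proj₁ r′≡) ⟩
  not (lookup (flipBefore k y′) k) ≡⟨ cong not (lookup-flipBefore-self k y′) ⟩
  not (lookup y′ k)                ≡⟨ sym (cong proj₂ r′≡) ⟩
  _                                ∎
  where open ≡-Reasoning

cliqueRule : ∀ {n} → List (𝔽₂^ n) → 𝔽₂^ n → Bool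
cliqueRule C = fromGraph (≡-dec _≟ᵇ_) false (requirements C)

SDS-cliqueRule : ∀ {n} {C : List (𝔽₂^ (suc n))} {y} → IsCliqueĤ C → y ∈ bases C →
  SDS (cliqueRule C) y ≡ complement y
SDS-cliqueRule clique y∈ = SDS≡complement _ _ λ k →
  fromGraph-∈ _ _ (requirements-functional clique) (∈-cartesianProductWith⁺ _ y∈ (∈-allFin k))

∈-bases : ∀ {n} {C : List (𝔽₂^ n)} {x} → x ∈ C → x ∈ bases C
∈-bases {C = C} {x} x∈C = subst (_∈ bases C) (map-id x)
  (∈-cartesianProductWith⁺ flipAll {xs = false ∷ true ∷ []} {a = false} (here refl) x∈C)

complement-∈-bases : ∀ {n} {C : List (𝔽₂^ n)} {x} → x ∈ C → complement x ∈ bases C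
complement-∈-bases =
  ∈-cartesianProductWith⁺ flipAll {xs = false ∷ true ∷ []} {a = true} (there (here refl))

vertex⇒complement-nonvertex : ∀ {n} (x : 𝔽₂^ (suc n)) → IsVertexĤ x → ¬ IsVertexĤ (complement x)
vertex⇒complement-nonvertex (false ∷ _) _ ()

lemma2 : (n : ℕ) → 2 ≤ suc n → (C : List (𝔽₂^ (suc n))) → IsCliqueĤ C →
    Σ (𝔽₂^ (suc n) → Bool) λ f →
      (∀ {x} → x ∈ C → OnTwoCycle (SDS f) x) ×
      (∀ {x y} → x ∈ C → y ∈ C → x ≢ y → ¬ SameTwoCycle (SDS f) x y)
lemma2 n _ C clique@(_ , vertex , _) = cliqueRule C , onTwoCycle , notSameTwoCycle
  where
  F = SDS (cliqueRule C)

  F-complement : ∀ {x} → x ∈ C → F x ≡ complement x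
  F-complement x∈C = SDS-cliqueRule clique (∈-bases x∈C)

  F-complement⁻¹ : ∀ {x} → x ∈ C → F (complement x) ≡ x
  F-complement⁻¹ {x} x∈C =
    trans (SDS-cliqueRule clique (complement-∈-bases x∈C)) (complement-involutive x)

  onTwoCycle : ∀ {x} → x ∈ C → OnTwoCycle F x
  onTwoCycle {x} x∈C =
    swap⇒OnTwoCycle {F = F} (complement-≢ x) (F-complement x∈C) (F-complement⁻¹ x∈C)

  notSameTwoCycle : ∀ {x y} → x ∈ C → y ∈ C → x ≢ y → ¬ SameTwoCycle F x y
  notSameTwoCycle {x} {y} x∈C y∈C x≢y same with SameTwoCycle⇒image x≢y same
  ... | inj₁ y≡Fx = vertex⇒complement-nonvertex x (vertex x∈C)
                      (subst IsVertexĤ (trans y≡Fx (F-complement x∈C)) (vertex y∈C))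
  ... | inj₂ x≡Fy = vertex⇒complement-nonvertex y (vertex y∈C)
                      (subst IsVertexĤ (trans x≡Fy (F-complement y∈C)) (vertex x∈C))
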